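{- Let $t$ be a complex number or an indeterminate, $F_j$ the Fibonacci numbers ($F_1=F_2=1$), and $I_{n,t}(x)=\prod_{i=1}^n\left(1+tx^{F_{i+1}}\right)$. Let $v_{2,t}(n)$ be the sum of the squares of the coefficients of $I_{n,t}(x)$ (as a polynomial in $x$). Then $$\sum_{n\ge0}v_{2,t}(n)x^n=\frac{1-(t^3+t)x^2}{1-(t^2+1)x-t(t^2+1)x^2+t(t^4+1)x^3}.$$ -}

module Defs where

open import Level using (Level)
open import Data.Nat using (ℕ; zero; suc; _∸_)
import Data.Nat as ℕ
open import Data.List using (List; []; _∷_; map; foldr; replicate; _++_; upTo)
open import Algebra.Bundles using (CommutativeRing)

fib : ℕ → ℕ
fib zero = zero
fib (suc zero) = suc zero
fib (suc (suc n)) = fib (suc n) ℕ.+ fib n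

module _ {c ℓ : Level} (R : CommutativeRing c ℓ) where
  open CommutativeRing R

  -- Polynomials in x over R, as coefficient lists (constant term first).
  padd : List Carrier → List Carrier → List Carrier
  padd [] q = q
  padd (a ∷ p) [] = a ∷ p
  padd (a ∷ p) (b ∷ q) = (a + b) ∷ padd p q

  pscale : Carrier → List Carrier → List Carrier
  pscale a p = map (a *_) p

  pmul : List Carrier → List Carrier → List Carrier
  pmul [] q = []
  pmul (a ∷ p) q = padd (pscale a q) (0# ∷ pmul p q)

  onePlusTXpow : Carrier → ℕ → List Carrier
  onePlusTXpow t k = padd (1# ∷ []) (replicate k 0# ++ (t ∷ []))

  Ipoly : Carrier → ℕ → List Carrier
  Ipoly t zero = 1# ∷ []
  Ipoly t (suc n) = pmul (Ipoly t n) (onePlusTXpow t (fib (suc (suc n))))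

  sumSquares : List Carrier → Carrier
  sumSquares p = foldr _+_ 0# (map (λ a → a * a) p)

  v2 : Carrier → ℕ → Carrier
  v2 t n = sumSquares (Ipoly t n)

  Series : Set c
  Series = ℕ → Carrier

  _⋆_ : Series → Series → Series
  (f ⋆ g) n = foldr _+_ 0# (map (λ k → f k * g (n ∸ k)) (upTo (suc n)))

  denom : Carrier → Series
  denom t zero = 1#
  denom t (suc zero) = - (t * t + 1#)
  denom t (suc (suc zero)) = - (t * (t * t + 1#))
  denom t (suc (suc (suc zero))) = t * ((t * t) * (t * t) + 1#)
  denom t (suc (suc (suc (suc n)))) = 0#

  numer : Carrier → Series
  numer t zero = 1#
  numer t (suc zero) = 0#
  numer t (suc (suc zero)) = - (t * (t * t) + t)
  numer t (suc (suc (suc n))) = 0#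

-- I_{n+1} = I_n (1 + t x^a) with a = F_{n+2}, and deg I_n < F_{n+3}. Expanding the inner
-- products V n = ⟨I_n, I_n⟩, C n = ⟨I_n, x^{F_{n+2}} I_n⟩ and D n = ⟨I_n, x^{F_{n+1}} I_n⟩ of
-- coefficient vectors bilinearly, every term pairing I_n with a shift by at least F_{n+3}
-- vanishes, leaving the linear system
--   V' = (1 + t²) V + 2t C,   C' = t D,   D' = t V + (1 + t²) C.
-- Its characteristic polynomial is λ³ − (t²+1) λ² − t(t²+1) λ + t(t⁴+1), so V satisfies the
-- matching third-order recurrence; with V 0 = 1, V 1 = t²+1 and V 2 = (t²+1)² this says exactly
-- that the denominator times the generating function of V is the stated numerator.

module Submission where

open import Defs
open import Level using (Level)
open import Data.Nat using (ℕ)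
open import Algebra.Bundles using (CommutativeRing)
open import Data.Nat as ℕ using (zero; suc; _≤_; z≤n; s≤s; _⊔_)
import Data.Nat.Properties as ℕ
open import Data.List using (List; []; _∷_; map; foldr; replicate; _++_; length; applyUpTo; upTo)
import Data.List.Properties as List
import Relation.Binary.PropositionalEquality as ≡
open ≡ using (_≡_)

module Polynomials {c ℓ : Level} (R : CommutativeRing c ℓ) where
  open CommutativeRing R
  open import Relation.Binary.Reasoning.Setoid setoid
  open import Algebra.Solver.Ring.NaturalCoefficients.Default commutativeSemiring
  open import Algebra.Properties.CommutativeSemigroup +-commutativeSemigroup using (interchange)

  Poly : Set c
  Poly = List Carrier

  coeff : Poly → ℕ → Carrier
  coeff [] i = 0#
  coeff (a ∷ p) zero = a
  coeff (a ∷ p) (suc i) = coeff p i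

  infix 4 _≋_
  record _≋_ (p q : Poly) : Set ℓ where
    constructor coeffwise
    field coeff-≈ : ∀ i → coeff p i ≈ coeff q i
  open _≋_ public

  ≋-refl : ∀ {p} → p ≋ p
  ≋-refl = coeffwise λ i → refl

  ≋-reflexive : ∀ {p q} → p ≡ q → p ≋ q
  ≋-reflexive ≡.refl = ≋-refl

  ≋-sym : ∀ {p q} → p ≋ q → q ≋ p
  ≋-sym h = coeffwise λ i → sym (coeff-≈ h i)

  ≋-trans : ∀ {p q r} → p ≋ q → q ≋ r → p ≋ r
  ≋-trans h k = coeffwise λ i → trans (coeff-≈ h i) (coeff-≈ k i)

  ∷-cong : ∀ {a b p q} → a ≈ b → p ≋ q → a ∷ p ≋ b ∷ q
  ∷-cong a≈b p≋q = coeffwise λ { zero → a≈b ; (suc i) → coeff-≈ p≋q i }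

  ∷-injectiveʳ : ∀ {a b p q} → a ∷ p ≋ b ∷ q → p ≋ q
  ∷-injectiveʳ h = coeffwise λ i → coeff-≈ h (suc i)

  []≋0∷[] : [] ≋ 0# ∷ []
  []≋0∷[] = coeffwise λ { zero → refl ; (suc i) → refl }

  coeff-padd : ∀ p q i → coeff (padd R p q) i ≈ coeff p i + coeff q i
  coeff-padd [] q i = sym (+-identityˡ _)
  coeff-padd (a ∷ p) [] i = sym (+-identityʳ _)
  coeff-padd (a ∷ p) (b ∷ q) zero = refl
  coeff-padd (a ∷ p) (b ∷ q) (suc i) = coeff-padd p q i

  coeff-pscale : ∀ a p i → coeff (pscale R a p) i ≈ a * coeff p i
  coeff-pscale a [] i = sym (zeroʳ a)
  coeff-pscale a (x ∷ p) zero = refl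
  coeff-pscale a (x ∷ p) (suc i) = coeff-pscale a p i

  padd-cong : ∀ {p p′ q q′} → p ≋ p′ → q ≋ q′ → padd R p q ≋ padd R p′ q′
  padd-cong {p} {p′} {q} {q′} h k = coeffwise λ i → begin
    coeff (padd R p q) i    ≈⟨ coeff-padd p q i ⟩
    coeff p i + coeff q i   ≈⟨ +-cong (coeff-≈ h i) (coeff-≈ k i) ⟩
    coeff p′ i + coeff q′ i ≈⟨ coeff-padd p′ q′ i ⟨
    coeff (padd R p′ q′) i  ∎

  pscale-cong : ∀ a {p p′} → p ≋ p′ → pscale R a p ≋ pscale R a p′
  pscale-cong a {p} {p′} h = coeffwise λ i → begin
    coeff (pscale R a p) i  ≈⟨ coeff-pscale a p i ⟩
    a * coeff p i           ≈⟨ *-congˡ (coeff-≈ h i) ⟩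
    a * coeff p′ i          ≈⟨ coeff-pscale a p′ i ⟨
    coeff (pscale R a p′) i ∎

  padd-interchange : ∀ p q r s → padd R (padd R p q) (padd R r s) ≋ padd R (padd R p r) (padd R q s)
  padd-interchange p q r s = coeffwise λ i → begin
    coeff (padd R (padd R p q) (padd R r s)) i
      ≈⟨ trans (coeff-padd (padd R p q) (padd R r s) i) (+-cong (coeff-padd p q i) (coeff-padd r s i)) ⟩
    (coeff p i + coeff q i) + (coeff r i + coeff s i)
      ≈⟨ interchange _ _ _ _ ⟩
    (coeff p i + coeff r i) + (coeff q i + coeff s i)
      ≈⟨ trans (coeff-padd (padd R p r) (padd R q s) i) (+-cong (coeff-padd p r i) (coeff-padd q s i)) ⟨
    coeff (padd R (padd R p r) (padd R q s)) i ∎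

  pscale-distrib-padd : ∀ a p q → pscale R a (padd R p q) ≋ padd R (pscale R a p) (pscale R a q)
  pscale-distrib-padd a p q = coeffwise λ i → begin
    coeff (pscale R a (padd R p q)) i
      ≈⟨ trans (coeff-pscale a (padd R p q) i) (*-congˡ (coeff-padd p q i)) ⟩
    a * (coeff p i + coeff q i)
      ≈⟨ distribˡ a _ _ ⟩
    a * coeff p i + a * coeff q i
      ≈⟨ trans (coeff-padd (pscale R a p) (pscale R a q) i) (+-cong (coeff-pscale a p i) (coeff-pscale a q i)) ⟨
    coeff (padd R (pscale R a p) (pscale R a q)) i ∎

  pscale-identity : ∀ p → pscale R 1# p ≋ p
  pscale-identity p = coeffwise λ i → trans (coeff-pscale 1# p i) (*-identityˡ _)

  shift : ℕ → Poly → Poly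
  shift k p = replicate k 0# ++ p

  shift-cong : ∀ k {p q} → p ≋ q → shift k p ≋ shift k q
  shift-cong zero h = h
  shift-cong (suc k) h = ∷-cong refl (shift-cong k h)

  shift-+ : ∀ m k p → shift m (shift k p) ≡ shift (m ℕ.+ k) p
  shift-+ zero k p = ≡.refl
  shift-+ (suc m) k p = ≡.cong (0# ∷_) (shift-+ m k p)

  shift-comm : ∀ m k p → shift m (shift k p) ≡ shift k (shift m p)
  shift-comm m k p =
    ≡.trans (shift-+ m k p) (≡.trans (≡.cong (λ j → shift j p) (ℕ.+-comm m k)) (≡.sym (shift-+ k m p)))

  shift-padd : ∀ k p q → shift k (padd R p q) ≋ padd R (shift k p) (shift k q)
  shift-padd zero p q = ≋-refl
  shift-padd (suc k) p q = ∷-cong (sym (+-identityˡ 0#)) (shift-padd k p q)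

  shift-pscale : ∀ k a p → shift k (pscale R a p) ≋ pscale R a (shift k p)
  shift-pscale zero a p = ≋-refl
  shift-pscale (suc k) a p = ∷-cong (sym (zeroʳ a)) (shift-pscale k a p)

  length-shift : ∀ k p → length (shift k p) ≡ k ℕ.+ length p
  length-shift k p = ≡.trans (List.length-++ (replicate k 0#)) (≡.cong (ℕ._+ length p) (List.length-replicate k))

  length-padd : ∀ p q → length (padd R p q) ≡ length p ⊔ length q
  length-padd [] q = ≡.refl
  length-padd (a ∷ p) [] = ≡.refl
  length-padd (a ∷ p) (b ∷ q) = ≡.cong suc (length-padd p q)

  pmul-0∷ʳ : ∀ p q → pmul R p (0# ∷ q) ≋ 0# ∷ pmul R p q
  pmul-0∷ʳ [] q = []≋0∷[]
  pmul-0∷ʳ (a ∷ p) q = ∷-cong (trans (+-identityʳ _) (zeroʳ a)) (padd-cong ≋-refl (pmul-0∷ʳ p q))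

  pmul-shiftʳ : ∀ k p q → pmul R p (shift k q) ≋ shift k (pmul R p q)
  pmul-shiftʳ zero p q = ≋-refl
  pmul-shiftʳ (suc k) p q = ≋-trans (pmul-0∷ʳ p (shift k q)) (∷-cong refl (pmul-shiftʳ k p q))

  pmul-constʳ : ∀ a p → pmul R p (a ∷ []) ≋ pscale R a p
  pmul-constʳ a [] = ≋-refl
  pmul-constʳ a (b ∷ p) = ∷-cong (trans (+-identityʳ _) (*-comm b a)) (pmul-constʳ a p)

  pmul-distribˡ-padd : ∀ p q r → pmul R p (padd R q r) ≋ padd R (pmul R p q) (pmul R p r)
  pmul-distribˡ-padd [] q r = ≋-refl
  pmul-distribˡ-padd (a ∷ p) q r =
    ≋-trans (padd-cong (pscale-distrib-padd a q r) (∷-cong (sym (+-identityˡ 0#)) (pmul-distribˡ-padd p q r)))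
            (padd-interchange (pscale R a q) (pscale R a r) (0# ∷ pmul R p q) (0# ∷ pmul R p r))

  grow : Carrier → ℕ → Poly → Poly
  grow s a p = padd R p (pscale R s (shift a p))

  length-grow : ∀ s a p → length (grow s a p) ≡ a ℕ.+ length p
  length-grow s a p = ≡.trans (length-padd p _)
    (≡.trans (≡.cong (length p ⊔_) (≡.trans (List.length-map _ (shift a p)) (length-shift a p)))
             (ℕ.m≤n⇒m⊔n≡n (ℕ.m≤n+m _ a)))

  pmul-onePlusTXpowʳ : ∀ t k p → pmul R p (onePlusTXpow R t k) ≋ grow t k p
  pmul-onePlusTXpowʳ t k p =
    ≋-trans (pmul-distribˡ-padd p (1# ∷ []) (shift k (t ∷ [])))
      (padd-cong (≋-trans (pmul-constʳ 1# p) (pscale-identity p))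
        (≋-trans (pmul-shiftʳ k p (t ∷ [])) (≋-trans (shift-cong k (pmul-constʳ t p)) (shift-pscale k t p))))

  ⟨_,_⟩ : Poly → Poly → Carrier
  ⟨ [] , q ⟩ = 0#
  ⟨ a ∷ p , [] ⟩ = 0#
  ⟨ a ∷ p , b ∷ q ⟩ = a * b + ⟨ p , q ⟩

  sumSquares≈⟨⟩ : ∀ p → sumSquares R p ≈ ⟨ p , p ⟩
  sumSquares≈⟨⟩ [] = refl
  sumSquares≈⟨⟩ (a ∷ p) = +-congˡ (sumSquares≈⟨⟩ p)

  ⟨⟩-comm : ∀ p q → ⟨ p , q ⟩ ≈ ⟨ q , p ⟩
  ⟨⟩-comm [] [] = refl
  ⟨⟩-comm [] (b ∷ q) = refl
  ⟨⟩-comm (a ∷ p) [] = refl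
  ⟨⟩-comm (a ∷ p) (b ∷ q) = +-cong (*-comm a b) (⟨⟩-comm p q)

  ⟨⟩-zeroˡ : ∀ {p} → p ≋ [] → ∀ q → ⟨ p , q ⟩ ≈ 0#
  ⟨⟩-zeroˡ {[]} h q = refl
  ⟨⟩-zeroˡ {a ∷ p} h [] = refl
  ⟨⟩-zeroˡ {a ∷ p} h (b ∷ q) = begin
    a * b + ⟨ p , q ⟩ ≈⟨ +-cong (*-congʳ (coeff-≈ h 0)) (⟨⟩-zeroˡ (∷-injectiveʳ (≋-trans h []≋0∷[])) q) ⟩
    0# * b + 0#       ≈⟨ trans (+-identityʳ _) (zeroˡ b) ⟩
    0#                ∎

  ⟨⟩-congˡ : ∀ {p p′} → p ≋ p′ → ∀ q → ⟨ p , q ⟩ ≈ ⟨ p′ , q ⟩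
  ⟨⟩-congˡ {[]} h q = sym (⟨⟩-zeroˡ (≋-sym h) q)
  ⟨⟩-congˡ {a ∷ p} {[]} h q = ⟨⟩-zeroˡ h q
  ⟨⟩-congˡ {a ∷ p} {a′ ∷ p′} h [] = refl
  ⟨⟩-congˡ {a ∷ p} {a′ ∷ p′} h (b ∷ q) = +-cong (*-congʳ (coeff-≈ h 0)) (⟨⟩-congˡ (∷-injectiveʳ h) q)

  ⟨⟩-congʳ : ∀ p {q q′} → q ≋ q′ → ⟨ p , q ⟩ ≈ ⟨ p , q′ ⟩
  ⟨⟩-congʳ p {q} {q′} h = trans (⟨⟩-comm p q) (trans (⟨⟩-congˡ h p) (⟨⟩-comm q′ p))

  ⟨⟩-paddˡ : ∀ p q r → ⟨ padd R p q , r ⟩ ≈ ⟨ p , r ⟩ + ⟨ q , r ⟩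
  ⟨⟩-paddˡ [] q r = sym (+-identityˡ _)
  ⟨⟩-paddˡ (a ∷ p) [] r = sym (+-identityʳ _)
  ⟨⟩-paddˡ (a ∷ p) (b ∷ q) [] = sym (+-identityʳ 0#)
  ⟨⟩-paddˡ (a ∷ p) (b ∷ q) (x ∷ r) = trans (+-congˡ (⟨⟩-paddˡ p q r))
    (solve 5 (λ a b x u v → (a :+ b) :* x :+ (u :+ v) := (a :* x :+ u) :+ (b :* x :+ v)) refl a b x ⟨ p , r ⟩ ⟨ q , r ⟩)

  ⟨⟩-pscaleˡ : ∀ a p r → ⟨ pscale R a p , r ⟩ ≈ a * ⟨ p , r ⟩
  ⟨⟩-pscaleˡ a [] r = sym (zeroʳ a)
  ⟨⟩-pscaleˡ a (x ∷ p) [] = sym (zeroʳ a)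
  ⟨⟩-pscaleˡ a (x ∷ p) (y ∷ r) = trans (+-congˡ (⟨⟩-pscaleˡ a p r))
    (solve 4 (λ a x y u → a :* x :* y :+ a :* u := a :* (x :* y :+ u)) refl a x y ⟨ p , r ⟩)

  ⟨⟩-linearˡ : ∀ s p q r → ⟨ padd R p (pscale R s q) , r ⟩ ≈ ⟨ p , r ⟩ + s * ⟨ q , r ⟩
  ⟨⟩-linearˡ s p q r = trans (⟨⟩-paddˡ p _ r) (+-congˡ (⟨⟩-pscaleˡ s q r))

  ⟨⟩-linearʳ : ∀ s r p q → ⟨ r , padd R p (pscale R s q) ⟩ ≈ ⟨ r , p ⟩ + s * ⟨ r , q ⟩
  ⟨⟩-linearʳ s r p q = begin
    ⟨ r , padd R p (pscale R s q) ⟩ ≈⟨ ⟨⟩-comm r _ ⟩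
    ⟨ padd R p (pscale R s q) , r ⟩ ≈⟨ ⟨⟩-linearˡ s p q r ⟩
    ⟨ p , r ⟩ + s * ⟨ q , r ⟩       ≈⟨ +-cong (⟨⟩-comm p r) (*-congˡ (⟨⟩-comm q r)) ⟩
    ⟨ r , p ⟩ + s * ⟨ r , q ⟩       ∎

  ⟨⟩-bilinear : ∀ s p q p′ q′ →
    ⟨ padd R p (pscale R s q) , padd R p′ (pscale R s q′) ⟩
      ≈ (⟨ p , p′ ⟩ + s * ⟨ p , q′ ⟩) + s * (⟨ q , p′ ⟩ + s * ⟨ q , q′ ⟩)
  ⟨⟩-bilinear s p q p′ q′ = trans (⟨⟩-linearˡ s p q _)
    (+-cong (⟨⟩-linearʳ s p p′ q′) (*-congˡ (⟨⟩-linearʳ s q p′ q′)))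

  ⟨⟩-shift : ∀ k p q → ⟨ shift k p , shift k q ⟩ ≈ ⟨ p , q ⟩
  ⟨⟩-shift zero p q = refl
  ⟨⟩-shift (suc k) p q = trans (+-cong (zeroˡ 0#) (⟨⟩-shift k p q)) (+-identityˡ _)

  ⟨⟩-shift-disjoint : ∀ k p q → length p ≤ k → ⟨ p , shift k q ⟩ ≈ 0#
  ⟨⟩-shift-disjoint k [] q h = refl
  ⟨⟩-shift-disjoint (suc k) (a ∷ p) q (s≤s h) =
    trans (+-cong (zeroʳ a) (⟨⟩-shift-disjoint k p q h)) (+-identityʳ 0#)

  ⟨⟩-grow : ∀ s a k p →
    ⟨ grow s a p , shift k (grow s a p) ⟩
      ≈ (⟨ p , shift k p ⟩ + s * ⟨ p , shift k (shift a p) ⟩)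
        + s * (⟨ shift a p , shift k p ⟩ + s * ⟨ p , shift k p ⟩)
  ⟨⟩-grow s a k p = begin
    ⟨ grow s a p , shift k (grow s a p) ⟩
      ≈⟨ ⟨⟩-congʳ (grow s a p) (≋-trans (shift-padd k p _) (padd-cong ≋-refl (shift-pscale k s (shift a p)))) ⟩
    ⟨ grow s a p , padd R (shift k p) (pscale R s (shift k (shift a p))) ⟩
      ≈⟨ ⟨⟩-bilinear s p (shift a p) (shift k p) (shift k (shift a p)) ⟩
    (⟨ p , shift k p ⟩ + s * ⟨ p , shift k (shift a p) ⟩)
      + s * (⟨ shift a p , shift k p ⟩ + s * ⟨ shift a p , shift k (shift a p) ⟩)
      ≈⟨ +-congˡ (*-congˡ (+-congˡ (*-congˡ shifted))) ⟩
    (⟨ p , shift k p ⟩ + s * ⟨ p , shift k (shift a p) ⟩)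
      + s * (⟨ shift a p , shift k p ⟩ + s * ⟨ p , shift k p ⟩) ∎
    where
    shifted : ⟨ shift a p , shift k (shift a p) ⟩ ≈ ⟨ p , shift k p ⟩
    shifted = trans (⟨⟩-congʳ (shift a p) (≋-reflexive (shift-comm k a p))) (⟨⟩-shift a p (shift k p))

module PowerSeries {c ℓ : Level} (R : CommutativeRing c ℓ) where
  open CommutativeRing R

  foldr-+-cong : ∀ {u w : ℕ → Carrier} → (∀ k → u k ≈ w k) → ∀ ks → foldr _+_ 0# (map u ks) ≈ foldr _+_ 0# (map w ks)
  foldr-+-cong u≈w [] = refl
  foldr-+-cong u≈w (k ∷ ks) = +-cong (u≈w k) (foldr-+-cong u≈w ks)

  foldr-+-zeros : ∀ (h : ℕ → Carrier) f m → (∀ x → h (f x) ≈ 0#) → foldr _+_ 0# (map h (applyUpTo f m)) ≈ 0#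
  foldr-+-zeros h f zero h≈0 = refl
  foldr-+-zeros h f (suc m) h≈0 =
    trans (+-cong (h≈0 0) (foldr-+-zeros h (λ x → f (suc x)) m (λ x → h≈0 (suc x)))) (+-identityʳ 0#)

  ⋆-congʳ : ∀ (f : Series R) {g h : Series R} → (∀ n → g n ≈ h n) → ∀ n → _⋆_ R f g n ≈ _⋆_ R f h n
  ⋆-congʳ f g≈h n = foldr-+-cong (λ k → *-congˡ (g≈h (n ℕ.∸ k))) (upTo (suc n))

module GeneratingFunction {c ℓ : Level} (R : CommutativeRing c ℓ) (t : CommutativeRing.Carrier R) where
  open CommutativeRing R
  open import Relation.Binary.Reasoning.Setoid setoid
  open import Algebra.Solver.Ring.NaturalCoefficients.Default commutativeSemiring
  open import Algebra.Properties.Ring ring using (-‿distribˡ-*)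
  open import Algebra.Properties.AbelianGroup +-abelianGroup using (⁻¹-∙-comm)
  open import Algebra.Properties.Group +-group using (x≈y⇒x∙y⁻¹≈ε)
  open PowerSeries R using (foldr-+-zeros)

  -- denom t = 1 − d₁ x − d₂ x² + d₃ x³
  d₁ d₂ d₃ : Carrier
  d₁ = t * t + 1#
  d₂ = t * (t * t + 1#)
  d₃ = t * ((t * t) * (t * t) + 1#)

  denom⋆≈numer : ∀ (g : Series R) → g 0 ≈ 1# → g 1 ≈ d₁ * g 0 → g 2 ≈ d₁ * g 1 →
    (∀ m → g (3 ℕ.+ m) + d₃ * g m ≈ d₁ * g (2 ℕ.+ m) + d₂ * g (1 ℕ.+ m)) →
    ∀ n → _⋆_ R (denom R t) g n ≈ numer R t n
  denom⋆≈numer g g0≈1 g1≈ g2≈ rec zero = begin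
    1# * g 0 + 0# ≈⟨ trans (+-identityʳ _) (*-identityˡ _) ⟩
    g 0           ≈⟨ g0≈1 ⟩
    1#            ∎
  denom⋆≈numer g g0≈1 g1≈ g2≈ rec (suc zero) = begin
    1# * g 1 + (- d₁ * g 0 + 0#) ≈⟨ +-cong (*-identityˡ _) (trans (+-identityʳ _) (sym (-‿distribˡ-* d₁ (g 0)))) ⟩
    g 1 - d₁ * g 0               ≈⟨ x≈y⇒x∙y⁻¹≈ε g1≈ ⟩
    0#                           ∎
  denom⋆≈numer g g0≈1 g1≈ g2≈ rec (suc (suc zero)) = begin
    1# * g 2 + (- d₁ * g 1 + (- d₂ * g 0 + 0#))
      ≈⟨ +-cong (*-identityˡ _) (+-cong (sym (-‿distribˡ-* d₁ (g 1))) (trans (+-identityʳ _) (sym (-‿distribˡ-* d₂ (g 0))))) ⟩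
    g 2 + (- (d₁ * g 1) + - (d₂ * g 0))
      ≈⟨ +-assoc _ _ _ ⟨
    (g 2 - d₁ * g 1) - d₂ * g 0
      ≈⟨ +-cong (x≈y⇒x∙y⁻¹≈ε g2≈) (-‿cong (trans (*-congˡ g0≈1) (*-identityʳ d₂))) ⟩
    0# - d₂
      ≈⟨ trans (+-identityˡ _) (-‿cong (trans (distribˡ t (t * t) 1#) (+-congˡ (*-identityʳ t)))) ⟩
    - (t * (t * t) + t) ∎
  denom⋆≈numer g g0≈1 g1≈ g2≈ rec (suc (suc (suc m))) = begin
    1# * x₃ + (- d₁ * x₂ + (- d₂ * x₁ + (d₃ * x₀ + rest)))
      ≈⟨ +-cong (*-identityˡ _) (+-cong (sym (-‿distribˡ-* d₁ x₂)) (+-cong (sym (-‿distribˡ-* d₂ x₁)) (+-congˡ rest≈0))) ⟩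
    x₃ + (- (d₁ * x₂) + (- (d₂ * x₁) + (d₃ * x₀ + 0#)))
      ≈⟨ solve 4 (λ a b c d → a :+ (b :+ (c :+ (d :+ con 0))) := (a :+ d) :+ (b :+ c)) refl x₃ _ _ (d₃ * x₀) ⟩
    (x₃ + d₃ * x₀) + (- (d₁ * x₂) + - (d₂ * x₁))
      ≈⟨ +-congˡ (⁻¹-∙-comm _ _) ⟩
    (x₃ + d₃ * x₀) - (d₁ * x₂ + d₂ * x₁)
      ≈⟨ x≈y⇒x∙y⁻¹≈ε (rec m) ⟩
    0# ∎
    where
    x₀ x₁ x₂ x₃ : Carrier
    x₀ = g m
    x₁ = g (1 ℕ.+ m)
    x₂ = g (2 ℕ.+ m)
    x₃ = g (3 ℕ.+ m)
    -- the terms k ≥ 4 of the Cauchy product, where the cubic denom vanishes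
    rest : Carrier
    rest = foldr _+_ 0# (map (λ k → denom R t k * g (3 ℕ.+ m ℕ.∸ k)) (applyUpTo (λ x → 4 ℕ.+ x) m))
    rest≈0 : rest ≈ 0#
    rest≈0 = foldr-+-zeros _ _ m (λ x → zeroˡ _)

fib-mono : ∀ n → fib n ≤ fib (suc n)
fib-mono zero = z≤n
fib-mono (suc zero) = s≤s z≤n
fib-mono (suc (suc n)) = ℕ.m≤m+n _ _

module FibonacciProduct {c ℓ : Level} (R : CommutativeRing c ℓ) (t : CommutativeRing.Carrier R) where
  open CommutativeRing R
  open import Relation.Binary.Reasoning.Setoid setoid
  open import Algebra.Solver.Ring.NaturalCoefficients.Default commutativeSemiring
  open Polynomials R
  open GeneratingFunction R t using (d₁; d₂; d₃)

  I : ℕ → Poly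
  I zero = 1# ∷ []
  I (suc n) = grow t (fib (2 ℕ.+ n)) (I n)

  Ipoly≋I : ∀ n → Ipoly R t n ≋ I n
  Ipoly≋I zero = ≋-refl
  Ipoly≋I (suc n) = ≋-trans (pmul-onePlusTXpowʳ t (fib (2 ℕ.+ n)) (Ipoly R t n))
    (padd-cong (Ipoly≋I n) (pscale-cong t (shift-cong (fib (2 ℕ.+ n)) (Ipoly≋I n))))

  length-I : ∀ n → length (I n) ≤ fib (3 ℕ.+ n)
  length-I zero = s≤s z≤n
  length-I (suc n) = ℕ.≤-trans (ℕ.≤-reflexive (length-grow t a (I n)))
    (ℕ.≤-trans (ℕ.+-monoʳ-≤ a (length-I n)) (ℕ.≤-reflexive (ℕ.+-comm a (fib (3 ℕ.+ n)))))
    where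
    a : ℕ
    a = fib (2 ℕ.+ n)

  V C D : ℕ → Carrier
  V n = ⟨ I n , I n ⟩
  C n = ⟨ I n , shift (fib (2 ℕ.+ n)) (I n) ⟩
  D n = ⟨ I n , shift (fib (1 ℕ.+ n)) (I n) ⟩

  V-suc : ∀ n → V (suc n) ≈ d₁ * V n + (t + t) * C n
  V-suc n = begin
    V (suc n)
      ≈⟨ ⟨⟩-grow t (fib (2 ℕ.+ n)) 0 (I n) ⟩
    (V n + t * C n) + t * (⟨ shift (fib (2 ℕ.+ n)) (I n) , I n ⟩ + t * V n)
      ≈⟨ +-congˡ (*-congˡ (+-congʳ (⟨⟩-comm _ (I n)))) ⟩
    (V n + t * C n) + t * (C n + t * V n)
      ≈⟨ solve 3 (λ t v c → (v :+ t :* c) :+ t :* (c :+ t :* v) := (t :* t :+ con 1) :* v :+ (t :+ t) :* c) refl t (V n) (C n) ⟩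
    d₁ * V n + (t + t) * C n ∎

  C-suc : ∀ n → C (suc n) ≈ t * D n
  C-suc n = begin
    C (suc n)
      ≈⟨ ⟨⟩-grow t a b (I n) ⟩
    (⟨ I n , shift b (I n) ⟩ + t * ⟨ I n , shift b (shift a (I n)) ⟩)
      + t * (⟨ shift a (I n) , shift b (I n) ⟩ + t * ⟨ I n , shift b (I n) ⟩)
      ≈⟨ +-cong (+-cong beyond (*-congˡ beyond₂)) (*-congˡ (+-cong common (*-congˡ beyond))) ⟩
    (0# + t * 0#) + t * (D n + t * 0#)
      ≈⟨ solve 2 (λ t d → (con 0 :+ t :* con 0) :+ t :* (d :+ t :* con 0) := t :* d) refl t (D n) ⟩
    t * D n ∎
    where
    a b : ℕ
    a = fib (2 ℕ.+ n)
    b = fib (3 ℕ.+ n)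
    beyond : ⟨ I n , shift b (I n) ⟩ ≈ 0#
    beyond = ⟨⟩-shift-disjoint b (I n) (I n) (length-I n)
    beyond₂ : ⟨ I n , shift b (shift a (I n)) ⟩ ≈ 0#
    beyond₂ = ⟨⟩-shift-disjoint b (I n) (shift a (I n)) (length-I n)
    common : ⟨ shift a (I n) , shift b (I n) ⟩ ≈ D n
    common = trans (⟨⟩-congʳ (shift a (I n)) (≋-reflexive (≡.sym (shift-+ a (fib (1 ℕ.+ n)) (I n)))))
                    (⟨⟩-shift a (I n) _)

  D-suc : ∀ n → D (suc n) ≈ t * V n + d₁ * C n
  D-suc n = begin
    D (suc n)
      ≈⟨ ⟨⟩-grow t a a (I n) ⟩
    (C n + t * ⟨ I n , shift a (shift a (I n)) ⟩) + t * (⟨ shift a (I n) , shift a (I n) ⟩ + t * C n)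
      ≈⟨ +-cong (+-congˡ (*-congˡ beyond)) (*-congˡ (+-congʳ (⟨⟩-shift a (I n) (I n)))) ⟩
    (C n + t * 0#) + t * (V n + t * C n)
      ≈⟨ solve 3 (λ t v c → (c :+ t :* con 0) :+ t :* (v :+ t :* c) := t :* v :+ (t :* t :+ con 1) :* c) refl t (V n) (C n) ⟩
    t * V n + d₁ * C n ∎
    where
    a : ℕ
    a = fib (2 ℕ.+ n)
    beyond : ⟨ I n , shift a (shift a (I n)) ⟩ ≈ 0#
    beyond = trans (⟨⟩-congʳ (I n) (≋-reflexive (shift-+ a a (I n))))
      (⟨⟩-shift-disjoint (a ℕ.+ a) (I n) (I n) (ℕ.≤-trans (length-I n) (ℕ.+-monoʳ-≤ a (fib-mono (1 ℕ.+ n)))))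


  V-suc-of-C≈0 : ∀ n → C n ≈ 0# → V (suc n) ≈ d₁ * V n
  V-suc-of-C≈0 n C≈0 = trans (V-suc n) (trans (+-congˡ (trans (*-congˡ C≈0) (zeroʳ _))) (+-identityʳ _))

  V-zero : V 0 ≈ 1#
  V-zero = trans (+-identityʳ _) (*-identityˡ 1#)

  V-one : V 1 ≈ d₁ * V 0
  V-one = V-suc-of-C≈0 0 (trans (+-identityʳ _) (zeroʳ 1#))

  V-two : V 2 ≈ d₁ * V 1
  V-two = V-suc-of-C≈0 1 (trans (C-suc 0) (trans (*-congˡ (trans (+-identityʳ _) (zeroʳ 1#))) (zeroʳ t)))

  V-recurrence : ∀ n → V (3 ℕ.+ n) + d₃ * V n ≈ d₁ * V (2 ℕ.+ n) + d₂ * V (1 ℕ.+ n)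
  V-recurrence n = begin
    V (3 ℕ.+ n) + d₃ * V n
      ≈⟨ +-congʳ (trans (V-suc (2 ℕ.+ n)) (+-congˡ (*-congˡ C₂))) ⟩
    (d₁ * V (2 ℕ.+ n) + (t + t) * (t * (t * V n + d₁ * C n))) + d₃ * V n
      ≈⟨ solve 4 (λ t w v c →
           let p = t :* t :+ con 1 in
           (p :* w :+ (t :+ t) :* (t :* (t :* v :+ p :* c))) :+ t :* ((t :* t) :* (t :* t) :+ con 1) :* v
             := p :* w :+ t :* p :* (p :* v :+ (t :+ t) :* c))
         refl t (V (2 ℕ.+ n)) (V n) (C n) ⟩
    d₁ * V (2 ℕ.+ n) + d₂ * (d₁ * V n + (t + t) * C n)
      ≈⟨ +-congˡ (*-congˡ (V-suc n)) ⟨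
    d₁ * V (2 ℕ.+ n) + d₂ * V (1 ℕ.+ n) ∎
    where
    C₂ : C (2 ℕ.+ n) ≈ t * (t * V n + d₁ * C n)
    C₂ = trans (C-suc (1 ℕ.+ n)) (*-congˡ (D-suc n))

  v2≈V : ∀ n → v2 R t n ≈ V n
  v2≈V n = trans (sumSquares≈⟨⟩ (Ipoly R t n))
    (trans (⟨⟩-congˡ (Ipoly≋I n) (Ipoly R t n)) (⟨⟩-congʳ (I n) (Ipoly≋I n)))

theorem6 : {c ℓ : Level} (R : CommutativeRing c ℓ) (t : CommutativeRing.Carrier R) →
    (n : ℕ) → CommutativeRing._≈_ R (_⋆_ R (denom R t) (v2 R t) n) (numer R t n)
theorem6 R t n = trans (⋆-congʳ (denom R t) v2≈V n) (denom⋆≈numer V V-zero V-one V-two V-recurrence n)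
  where
  open CommutativeRing R using (trans)
  open PowerSeries R using (⋆-congʳ)
  open GeneratingFunction R t using (denom⋆≈numer)
  open FibonacciProduct R t
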